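{- Let $m \geq 2$, $n \geq 2$, and let $G = K_{1(n),m} = O_m \vee K_n$, with $V_0 = V(O_m)$ the partite set of size $m$. Let $f$ be a maximal IC-coloring of $G$ and let $u_1, \dots, u_{m+n}$ be an enumeration of $V(G)$ with $f(u_1) < f(u_2) < \dots < f(u_{m+n})$. Put $s_0 = 0$, $s_i = f(u_i)$ for $i \in \{1, \dots, m+n\}$, and let $r_i = s_i - \sum_{j=0}^{i-1} s_j$ for $i \in \{1, \dots, m+n\}$. Then $r_i \leq 1$ for all $i$. Furthermore, let $k_0 = \max\{j : u_j \in V_0\}$; if $r_i \leq 0$ for every $i$ with $u_i \in V_0 \setminus \{u_{k_0}\}$, then $f(G) \leq 2^{m+n} - 2^m + 1$.
   Context: For a connected graph $G$, a coloring is a function $f: V(G) \to \mathbb{N}$ (positive integers); for a subgraph $H$, $f(H) = \sum_{v \in V(H)} f(v)$. $f$ is an IC-coloring if for every integer $k \in \{1, \dots, f(G)\}$ there is an induced connected subgraph $H$ of $G$ with $f(H) = k$. The IC-index $M(G)$ is the maximum of $f(G)$ over IC-colorings, and an IC-coloring achieving it is a maximal IC-coloring. $O_m$ is the edgeless graph on $m$ vertices, $K_n$ the complete graph, and $O_m \vee K_n$ their join (all edges between the two vertex sets added); this is the complete multipartite graph $K_{1(n),m}$. -}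

module Defs where

open import Data.Nat using (ℕ; zero; suc; _+_; _≤_; _<_; _<ᵇ_)
open import Data.Bool using (Bool; true; false; if_then_else_)
open import Data.Fin using (Fin; toℕ)
open import Data.Vec using (Vec; lookup; tabulate)
import Data.Vec as Vec
open import Data.Product using (_×_; Σ; ∃)
open import Relation.Nullary using (¬_)
open import Relation.Binary.PropositionalEquality using (_≡_; _≢_)

-- A graph on vertex set Fin N is given by its adjacency relation.
-- A subset of vertices is a boolean vector (true = in the subset).
Subset : ℕ → Set
Subset N = Vec Bool N

_∈S_ : ∀ {N} → Fin N → Subset N → Set
v ∈S S = lookup S v ≡ true

-- Walks that stay inside S (so they are walks in the induced subgraph G[S]).
data Walk {N : ℕ} (Adj : Fin N → Fin N → Set) (S : Subset N) : Fin N → Fin N → Set where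
  here : ∀ {a} → a ∈S S → Walk Adj S a a
  step : ∀ {a b c} → a ∈S S → Adj a b → Walk Adj S b c → Walk Adj S a c

InducedConnected : ∀ {N} → (Fin N → Fin N → Set) → Subset N → Set
InducedConnected {N} Adj S =
  (∃ λ (v : Fin N) → v ∈S S) × (∀ a b → a ∈S S → b ∈S S → Walk Adj S a b)

total : ∀ {N} → (Fin N → ℕ) → ℕ
total f = Vec.sum (tabulate f)

weight : ∀ {N} → (Fin N → ℕ) → Subset N → ℕ
weight f S = total (λ v → if lookup S v then f v else 0)

IsColoring : ∀ {N} → (Fin N → ℕ) → Set
IsColoring f = ∀ v → 1 ≤ f v

IsICColoring : ∀ {N} → (Fin N → Fin N → Set) → (Fin N → ℕ) → Set
IsICColoring {N} Adj f =
  IsColoring f ×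
  (∀ k → 1 ≤ k → k ≤ total f →
     Σ (Subset N) λ S → InducedConnected Adj S × weight f S ≡ k)

IsMaximalICColoring : ∀ {N} → (Fin N → Fin N → Set) → (Fin N → ℕ) → Set
IsMaximalICColoring {N} Adj f =
  IsICColoring Adj f × (∀ (g : Fin N → ℕ) → IsICColoring Adj g → total g ≤ total f)

-- The graph O_m ∨ K_n on vertex set Fin (m + n); vertices with index < m form
-- V₀ = V(O_m), the remaining n form K_n.
InV0 : (m : ℕ) {n : ℕ} → Fin (m + n) → Set
InV0 m v = toℕ v < m

AdjOK : (m n : ℕ) → Fin (m + n) → Fin (m + n) → Set
AdjOK m n a b = a ≢ b × ¬ (InV0 m a × InV0 m b)

-- sum_{j < i} g j  (0-based indices; s₀ = 0 contributes nothing)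
prefixSum : ∀ {N} → (Fin N → ℕ) → Fin N → ℕ
prefixSum g i = total (λ j → if toℕ j <ᵇ toℕ i then g j else 0)

-- Write Sᵢ for the sum of the i smallest colours. If f(uᵢ₊₁) > Sᵢ + 1, no vertex set
-- weighs Sᵢ + 1: such a set avoids uᵢ₊₁, uᵢ₊₂, … and so weighs at most Sᵢ. Hence rᵢ ≤ 1,
-- i.e. Sᵢ₊₁ ≤ 2Sᵢ + 1, and Sᵢ₊₁ ≤ 2Sᵢ at a vertex of V₀ with rᵢ ≤ 0. If cᵢ counts the
-- V₀-vertices among u₁, …, uᵢ, then Sᵢ + 2^cᵢ ≤ 2ⁱ up to the last V₀-vertex; that step
-- costs a slack of 1, and Sᵢ + 2^cᵢ ≤ 2ⁱ + 1 survives the remaining steps because by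
-- then 2^cᵢ ≥ 2. At the end S = f(G) and c = m.
module Submission where

open import Defs
open import Data.Nat using (ℕ; zero; suc; _+_; _*_; _∸_; _^_; _≤_; _<_; _<ᵇ_; z≤n; s≤s; _<?_)
open import Data.Nat.Properties
open import Data.Nat.Tactic.RingSolver using (solve-∀)
open import Data.Fin using (Fin; toℕ; fromℕ<) renaming (zero to fzero; suc to fsuc)
import Data.Fin as F
open import Data.Fin.Properties using (toℕ-fromℕ<; toℕ-injective; toℕ<n) renaming (≤∧≢⇒< to ≤∧≢⇒<ᶠ)
open import Data.Integer using (+_; _-_)
import Data.Integer as Z
import Data.Integer.Properties as ℤ
import Data.Integer.Tactic.RingSolver as ℤ-Solver
open import Data.Bool using (true; false; if_then_else_; T)
open import Data.Vec using (lookup)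
open import Data.Product using (_×_; _,_; ∃; proj₂)
open import Function using (_∘_)
open import Function.Bundles using (mk⤖)
open import Function.Definitions using (Bijective)
open import Function.Properties.Bijection using (⤖⇒↔)
open import Relation.Nullary using (¬_; yes; no; does; contradiction)
open import Relation.Nullary.Decidable using (dec-true; dec-false)
open import Relation.Unary using (Decidable)
open import Relation.Binary using (tri<; tri≈; tri>)
open import Relation.Binary.PropositionalEquality
  using (_≡_; _≢_; refl; sym; trans; cong; cong₂; subst; subst₂; module ≡-Reasoning)
open import Algebra.Properties.CommutativeSemigroup +-commutativeSemigroup using (x∙yz≈y∙xz)
import Algebra.Properties.CommutativeMonoid.Sum as CommutativeMonoidSum

module Sum = CommutativeMonoidSum +-0-commutativeMonoid

total≡sum : ∀ {N} (a : Fin N → ℕ) → total a ≡ Sum.sum a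
total≡sum {zero} a = refl
total≡sum {suc N} a = cong (_+_ (a fzero)) (total≡sum (a ∘ fsuc))

total-permute : ∀ {N} (a : Fin N → ℕ) {u : Fin N → Fin N} →
                Bijective _≡_ _≡_ u → total a ≡ total (a ∘ u)
total-permute a {u} bij = begin
  total a         ≡⟨ total≡sum a ⟩
  Sum.sum a       ≡⟨ Sum.sum-permute a (⤖⇒↔ (mk⤖ bij)) ⟩
  Sum.sum (a ∘ u) ≡⟨ total≡sum (a ∘ u) ⟨
  total (a ∘ u)   ∎
  where open ≡-Reasoning

total-mono : ∀ {N} {a b : Fin N → ℕ} → (∀ j → a j ≤ b j) → total a ≤ total b
total-mono {zero} a≤b = z≤n
total-mono {suc N} a≤b = +-mono-≤ (a≤b fzero) (total-mono (a≤b ∘ fsuc))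

term≤total : ∀ {N} (a : Fin N → ℕ) i → a i ≤ total a
term≤total a fzero = m≤m+n _ _
term≤total a (fsuc i) = ≤-trans (term≤total (a ∘ fsuc) i) (m≤n+m _ _)

sumBelow : ∀ {N} → (Fin N → ℕ) → ℕ → ℕ
sumBelow g k = total (λ j → if toℕ j <ᵇ k then g j else 0)

sumBelow-zero : ∀ {N} (g : Fin N → ℕ) → sumBelow g 0 ≡ 0
sumBelow-zero {zero} g = refl
sumBelow-zero {suc N} g = sumBelow-zero (g ∘ fsuc)

sumBelow-suc : ∀ {N} (g : Fin N → ℕ) i → sumBelow g (suc (toℕ i)) ≡ g i + sumBelow g (toℕ i)
sumBelow-suc g fzero = refl
sumBelow-suc g (fsuc i) = begin
  g fzero + sumBelow (g ∘ fsuc) (suc (toℕ i))          ≡⟨ cong (_+_ (g fzero)) (sumBelow-suc (g ∘ fsuc) i) ⟩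
  g fzero + (g (fsuc i) + sumBelow (g ∘ fsuc) (toℕ i)) ≡⟨ x∙yz≈y∙xz (g fzero) (g (fsuc i)) _ ⟩
  g (fsuc i) + (g fzero + sumBelow (g ∘ fsuc) (toℕ i)) ∎
  where open ≡-Reasoning

sumBelow-all : ∀ {N} (g : Fin N → ℕ) → sumBelow g N ≡ total g
sumBelow-all {zero} g = refl
sumBelow-all {suc N} g = cong (_+_ (g fzero)) (sumBelow-all (g ∘ fsuc))

indicator : ∀ {N} {P : Fin N → Set} → Decidable P → Fin N → ℕ
indicator P? i = if does (P? i) then 1 else 0

count-toℕ< : ∀ {N} k → k ≤ N → total (indicator {N} (λ v → toℕ v <? k)) ≡ k
count-toℕ< {zero} zero _ = refl
count-toℕ< {suc N} zero _ = count-toℕ< {N} zero z≤n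
count-toℕ< {suc N} (suc k) (s≤s k≤N) = cong suc (count-toℕ< k k≤N)

prefix-induction : ∀ {N} (Q : ℕ → Set) → Q 0 → (∀ (i : Fin N) → Q (toℕ i) → Q (suc (toℕ i))) →
                   ∀ k → k ≤ N → Q k
prefix-induction Q base advance zero _ = base
prefix-induction Q base advance (suc k) k<N =
  subst (Q ∘ suc) (toℕ-fromℕ< k<N)
    (advance (fromℕ< k<N)
      (subst Q (sym (toℕ-fromℕ< k<N)) (prefix-induction Q base advance k (<⇒≤ k<N))))

∈S⇒≤weight : ∀ {N} (f : Fin N → ℕ) {S : Subset N} {v} → v ∈S S → f v ≤ weight f S
∈S⇒≤weight f {S} {v} v∈S =
  subst (_≤ weight f S) (cong (λ b → if b then f v else 0) v∈S)
    (term≤total (λ w → if lookup S w then f w else 0) v)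

weight≤sumBelow : ∀ {N} (f : Fin N → ℕ) {u : Fin N → Fin N} → Bijective _≡_ _≡_ u →
                  ∀ {S : Subset N} k → (∀ j → u j ∈S S → toℕ j < k) →
                  weight f S ≤ sumBelow (f ∘ u) k
weight≤sumBelow f {u} bij {S} k below =
  subst (_≤ sumBelow (f ∘ u) k) (sym (total-permute (λ v → if lookup S v then f v else 0) bij))
    (total-mono pointwise)
  where
  pointwise : ∀ j → (if lookup S (u j) then f (u j) else 0) ≤ (if toℕ j <ᵇ k then f (u j) else 0)
  pointwise j with lookup S (u j) in uj∈S | toℕ j <ᵇ k in j<ᵇk
  ... | false | _     = z≤n
  ... | true  | true  = ≤-refl
  ... | true  | false = contradiction (subst T j<ᵇk (<⇒<ᵇ (below j uj∈S))) λ ()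

strictMono⇒reflects-< : ∀ {N} (g : Fin N → ℕ) → (∀ i j → i F.< j → g i < g j) →
                        ∀ i j → g i < g j → i F.< j
strictMono⇒reflects-< g mono i j gi<gj with <-cmp (toℕ i) (toℕ j)
... | tri< i<j _ _ = i<j
... | tri≈ _ i≡j _ = contradiction (cong g (toℕ-injective i≡j)) (<⇒≢ gi<gj)
... | tri> _ _ j<i = contradiction (mono j i j<i) (<⇒≯ gi<gj)

EveryWeightAttained : ∀ {N} → (Fin N → ℕ) → Set
EveryWeightAttained {N} f = ∀ k → 1 ≤ k → k ≤ total f → ∃ λ (S : Subset N) → weight f S ≡ k

lighter⇒weight≤sumBelow : ∀ {N} (f : Fin N → ℕ) {u : Fin N → Fin N} → Bijective _≡_ _≡_ u →
                          (∀ i j → i F.< j → f (u i) < f (u j)) →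
                          ∀ i {S : Subset N} → weight f S < f (u i) →
                          weight f S ≤ sumBelow (f ∘ u) (toℕ i)
lighter⇒weight≤sumBelow f {u} bij mono i {S} wS<fui = weight≤sumBelow f bij {S} (toℕ i) below
  where
  below : ∀ j → u j ∈S S → toℕ j < toℕ i
  below j uj∈S =
    strictMono⇒reflects-< (f ∘ u) mono j i (≤-<-trans (∈S⇒≤weight f {S} uj∈S) wS<fui)

sorted-term≤suc-sumBelow : ∀ {N} (f : Fin N → ℕ) {u : Fin N → Fin N} → Bijective _≡_ _≡_ u →
                           (∀ i j → i F.< j → f (u i) < f (u j)) → EveryWeightAttained f →
                           ∀ i → f (u i) ≤ 1 + sumBelow (f ∘ u) (toℕ i)
sorted-term≤suc-sumBelow f {u} bij mono attained i = ≮⇒≥ 1+p≮fui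
  where
  p : ℕ
  p = sumBelow (f ∘ u) (toℕ i)
  1+p≮fui : ¬ 1 + p < f (u i)
  1+p≮fui 1+p<fui with attained (1 + p) (s≤s z≤n) (≤-trans (<⇒≤ 1+p<fui) (term≤total f (u i)))
  ... | S , wS≡1+p = n≮n p (subst (_≤ p) wS≡1+p (lighter⇒weight≤sumBelow f bij mono i {S} wS<fui))
    where
    wS<fui : weight f S < f (u i)
    wS<fui = subst (_< f (u i)) (sym wS≡1+p) 1+p<fui

double-marked : ∀ {s t B x} → s + t ≤ B → x ≤ s → x + s + 2 * t ≤ 2 * B
double-marked {s} {t} {B} {x} s+t≤B x≤s = begin
  x + s + 2 * t ≤⟨ +-monoˡ-≤ (2 * t) (+-monoˡ-≤ s x≤s) ⟩
  s + s + 2 * t ≡⟨ identity s t ⟩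
  2 * (s + t)   ≤⟨ *-monoʳ-≤ 2 s+t≤B ⟩
  2 * B         ∎
  where
  open ≤-Reasoning
  identity : ∀ s t → s + s + 2 * t ≡ 2 * (s + t)
  identity = solve-∀

double-unmarked : ∀ {s t B x} → 1 ≤ t → s + t ≤ B → x ≤ 1 + s → x + s + t ≤ 2 * B
double-unmarked {s} {t} {B} {x} 1≤t s+t≤B x≤1+s = begin
  x + s + t     ≤⟨ +-monoˡ-≤ t (+-monoˡ-≤ s (≤-trans x≤1+s (+-monoˡ-≤ s 1≤t))) ⟩
  t + s + s + t ≡⟨ identity s t ⟩
  2 * (s + t)   ≤⟨ *-monoʳ-≤ 2 s+t≤B ⟩
  2 * B         ∎
  where
  open ≤-Reasoning
  identity : ∀ s t → t + s + s + t ≡ 2 * (s + t)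
  identity = solve-∀

double-last-marked : ∀ {s t B x} → s + t ≤ B → x ≤ 1 + s → x + s + 2 * t ≤ 2 * B + 1
double-last-marked {s} {t} {B} {x} s+t≤B x≤1+s = begin
  x + s + 2 * t     ≤⟨ +-monoˡ-≤ (2 * t) (+-monoˡ-≤ s x≤1+s) ⟩
  1 + s + s + 2 * t ≡⟨ identity s t ⟩
  2 * (s + t) + 1   ≤⟨ +-monoˡ-≤ 1 (*-monoʳ-≤ 2 s+t≤B) ⟩
  2 * B + 1         ∎
  where
  open ≤-Reasoning
  identity : ∀ s t → 1 + s + s + 2 * t ≡ 2 * (s + t) + 1
  identity = solve-∀

double-after-last : ∀ {s t B x} → 2 ≤ t → s + t ≤ B + 1 → x ≤ 1 + s → x + s + t ≤ 2 * B + 1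
double-after-last {s} {t} {B} {x} 2≤t s+t≤B+1 x≤1+s = +-cancelʳ-≤ 2 _ _ (begin
  x + s + t + 2         ≤⟨ +-mono-≤ (+-monoˡ-≤ t (+-monoˡ-≤ s x≤1+s)) 2≤t ⟩
  1 + s + s + t + t     ≡⟨ identity₁ s t ⟩
  2 * (s + t) + 1       ≤⟨ +-monoˡ-≤ 1 (*-monoʳ-≤ 2 s+t≤B+1) ⟩
  2 * (B + 1) + 1       ≡⟨ identity₂ B ⟩
  2 * B + 1 + 2         ∎)
  where
  open ≤-Reasoning
  identity₁ : ∀ s t → 1 + s + s + t + t ≡ 2 * (s + t) + 1
  identity₁ = solve-∀
  identity₂ : ∀ B → 2 * (B + 1) + 1 ≡ 2 * B + 1 + 2
  identity₂ = solve-∀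

doubling-bound : ∀ {N} (g : Fin N → ℕ) {Marked : Fin N → Set} (marked? : Decidable Marked) →
                 ∀ k₀ →
                 (∀ i → g i ≤ 1 + sumBelow g (toℕ i)) →
                 (∀ i → Marked i → i ≢ k₀ → g i ≤ sumBelow g (toℕ i)) →
                 Marked k₀ → (∀ i → Marked i → i F.≤ k₀) →
                 total g + 2 ^ total (indicator marked?) ≤ 2 ^ N + 1
doubling-bound {N} g {Marked} marked? k₀ r≤1 r≤0 k₀-marked k₀-last =
  subst₂ (λ a b → a + 2 ^ b ≤ 2 ^ N + 1) (sumBelow-all g) (sumBelow-all (indicator marked?))
    (proj₂ (after N ≤-refl (toℕ<n k₀)))
  where
  s c : ℕ → ℕ
  s = sumBelow g
  c = sumBelow (indicator marked?)

  c-suc-marked : ∀ {i} → Marked i → c (suc (toℕ i)) ≡ suc (c (toℕ i))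
  c-suc-marked {i} mk = trans (sumBelow-suc (indicator marked?) i)
    (cong (λ b → (if b then 1 else 0) + c (toℕ i)) (dec-true (marked? i) mk))

  c-suc-unmarked : ∀ {i} → ¬ Marked i → c (suc (toℕ i)) ≡ c (toℕ i)
  c-suc-unmarked {i} ¬mk = trans (sumBelow-suc (indicator marked?) i)
    (cong (λ b → (if b then 1 else 0) + c (toℕ i)) (dec-false (marked? i) ¬mk))

  Before After : ℕ → Set
  Before k = s k + 2 ^ c k ≤ 2 ^ k
  After k = 1 ≤ c k × s k + 2 ^ c k ≤ 2 ^ k + 1

  before-zero : Before 0
  before-zero = subst₂ (λ a b → a + 2 ^ b ≤ 1)
    (sym (sumBelow-zero g)) (sym (sumBelow-zero (indicator marked?))) ≤-refl

  before-suc-marked : ∀ i → Marked i → i ≢ k₀ → Before (toℕ i) → Before (suc (toℕ i))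
  before-suc-marked i mk i≢k₀ bound rewrite sumBelow-suc g i | c-suc-marked mk =
    double-marked bound (r≤0 i mk i≢k₀)

  before-suc-unmarked : ∀ i → ¬ Marked i → Before (toℕ i) → Before (suc (toℕ i))
  before-suc-unmarked i ¬mk bound rewrite sumBelow-suc g i | c-suc-unmarked ¬mk =
    double-unmarked (m^n>0 2 (c (toℕ i))) bound (r≤1 i)

  after-k₀ : Before (toℕ k₀) → After (suc (toℕ k₀))
  after-k₀ bound rewrite sumBelow-suc g k₀ | c-suc-marked k₀-marked =
    s≤s z≤n , double-last-marked bound (r≤1 k₀)

  after-suc-unmarked : ∀ i → ¬ Marked i → After (toℕ i) → After (suc (toℕ i))
  after-suc-unmarked i ¬mk (1≤c , bound) rewrite sumBelow-suc g i | c-suc-unmarked ¬mk =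
    1≤c , double-after-last (^-monoʳ-≤ 2 1≤c) bound (r≤1 i)

  before-suc : ∀ i → (toℕ i ≤ toℕ k₀ → Before (toℕ i)) → toℕ i < toℕ k₀ → Before (suc (toℕ i))
  before-suc i ih i<k₀ with marked? i
  ... | yes mk = before-suc-marked i mk (λ i≡k₀ → <-irrefl (cong toℕ i≡k₀) i<k₀) (ih (<⇒≤ i<k₀))
  ... | no ¬mk = before-suc-unmarked i ¬mk (ih (<⇒≤ i<k₀))

  before : ∀ k → k ≤ N → k ≤ toℕ k₀ → Before k
  before = prefix-induction (λ k → k ≤ toℕ k₀ → Before k) (λ _ → before-zero) before-suc

  after-suc : ∀ i → (toℕ k₀ < toℕ i → After (toℕ i)) → toℕ k₀ < suc (toℕ i) → After (suc (toℕ i))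
  after-suc i ih k₀<1+i with i F.≟ k₀
  ... | yes refl = after-k₀ (before (toℕ k₀) (<⇒≤ (toℕ<n k₀)) ≤-refl)
  ... | no i≢k₀ = after-suc-unmarked i (λ mk → <⇒≱ k₀<i (k₀-last i mk)) (ih k₀<i)
    where
    k₀<i : k₀ F.< i
    k₀<i = ≤∧≢⇒<ᶠ (≤-pred k₀<1+i) (i≢k₀ ∘ sym)

  after : ∀ k → k ≤ N → toℕ k₀ < k → After k
  after = prefix-induction (λ k → toℕ k₀ < k → After k) (λ ()) after-suc

[+m]-[+n]≤[+o]⇒m≤o+n : ∀ {m n o} → + m - + n Z.≤ + o → m ≤ o + n
[+m]-[+n]≤[+o]⇒m≤o+n {m} {n} {o} m-n≤o = ℤ.drop‿+≤+ (begin
  + m               ≡⟨ identity (+ m) (+ n) ⟩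
  + m - + n Z.+ + n ≤⟨ ℤ.+-monoˡ-≤ (+ n) m-n≤o ⟩
  + o Z.+ + n       ∎)
  where
  open ℤ.≤-Reasoning
  identity : ∀ i j → i ≡ i - j Z.+ j
  identity = ℤ-Solver.solve-∀

m≤o+n⇒[+m]-[+n]≤[+o] : ∀ {m n o} → m ≤ o + n → + m - + n Z.≤ + o
m≤o+n⇒[+m]-[+n]≤[+o] {m} {n} {o} m≤o+n = begin
  + m - + n         ≤⟨ ℤ.+-monoˡ-≤ (Z.- + n) (Z.+≤+ m≤o+n) ⟩
  + o Z.+ + n - + n ≡⟨ identity (+ o) (+ n) ⟨
  + o               ∎
  where
  open ℤ.≤-Reasoning
  identity : ∀ i j → i ≡ i Z.+ j - j
  identity = ℤ-Solver.solve-∀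

lemma3p7 : (m n : ℕ) → 2 ≤ m → 2 ≤ n →
    (f : Fin (m + n) → ℕ) → IsMaximalICColoring (AdjOK m n) f →
    (u : Fin (m + n) → Fin (m + n)) → Bijective _≡_ _≡_ u →
    (∀ i j → i F.< j → f (u i) < f (u j)) →
    (∀ i → (+ f (u i)) - (+ prefixSum (λ j → f (u j)) i) Z.≤ + 1)
    ×
    (∀ k₀ → InV0 m (u k₀) → (∀ j → InV0 m (u j) → j F.≤ k₀) →
      (∀ i → InV0 m (u i) → i ≢ k₀ →
        (+ f (u i)) - (+ prefixSum (λ j → f (u j)) i) Z.≤ + 0) →
      total f ≤ 2 ^ (m + n) ∸ 2 ^ m + 1)
lemma3p7 m n _ _ f ((_ , connected-weights) , _) u bij mono =
  m≤o+n⇒[+m]-[+n]≤[+o] ∘ r≤1 , bound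
  where
  attained : EveryWeightAttained f
  attained k 1≤k k≤total with connected-weights k 1≤k k≤total
  ... | S , _ , wS≡k = S , wS≡k

  r≤1 : ∀ i → f (u i) ≤ 1 + prefixSum (f ∘ u) i
  r≤1 = sorted-term≤suc-sumBelow f bij mono attained

  u∈V₀? : Decidable (InV0 m ∘ u)
  u∈V₀? i = toℕ (u i) <? m

  count-V₀ : total (indicator u∈V₀?) ≡ m
  count-V₀ = trans (sym (total-permute (indicator (λ v → toℕ v <? m)) bij)) (count-toℕ< m (m≤m+n m n))

  bound : ∀ k₀ → InV0 m (u k₀) → (∀ j → InV0 m (u j) → j F.≤ k₀) →
          (∀ i → InV0 m (u i) → i ≢ k₀ → + f (u i) - + prefixSum (f ∘ u) i Z.≤ + 0) →
          total f ≤ 2 ^ (m + n) ∸ 2 ^ m + 1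
  bound k₀ k₀∈V₀ k₀-last r≤0 =
    subst (total f ≤_) (+-∸-comm 1 (^-monoʳ-≤ 2 (m≤m+n m n))) (m+n≤o⇒m≤o∸n (total f) (begin
      total f + 2 ^ m
        ≡⟨ cong₂ _+_ (total-permute f bij) (cong (2 ^_) (sym count-V₀)) ⟩
      total (f ∘ u) + 2 ^ total (indicator u∈V₀?)
        ≤⟨ doubling-bound (f ∘ u) u∈V₀? k₀ r≤1 r≤0ℕ k₀∈V₀ k₀-last ⟩
      2 ^ (m + n) + 1
        ∎))
    where
    open ≤-Reasoning
    r≤0ℕ : ∀ i → InV0 m (u i) → i ≢ k₀ → f (u i) ≤ prefixSum (f ∘ u) i
    r≤0ℕ i i∈V₀ i≢k₀ = [+m]-[+n]≤[+o]⇒m≤o+n (r≤0 i i∈V₀ i≢k₀)
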